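{- Let $\{G_k\}_{k\ge1}$ be a worst-case family and $k\ge1$. Then the induced subgame tree $T_k=\{G_w\}_{w\in\{L,R\}^{\le k}}\cup\{G'_w\}_{w\in\{L,R\}^{\le k+1},\,w\ne\varepsilon}$ consists of pairwise distinct games, and $|T_k|=3(2^{k+1}-1)$.
   Context: Parity games $G=(V_0,V_1,E,\mathrm{pr})$: finite positions $V=V_0\sqcup V_1$ owned by players $0,1$, left-total moves $E$, priorities $\mathrm{pr}:V\to\mathbb N$; player $0$ wins a play iff the maximal priority seen infinitely often is even; $W^\wp(G)$ is the winning region of player $\wp$. For $X\subseteq V$, the $\wp$-attractor $\mathrm{Attr}^\wp_G(X)$ is the least $A\supseteq X$ containing every $\wp$-position with some successor in $A$ and every $(1-\wp)$-position with all successors in $A$; $G\setminus A$ is the game restricted to $V\setminus A$. Core game $G^C_k$ ($k\ge1$): positions $\alpha_i,\beta_i,\gamma_i$ for $i\in[0,2k]$; $\alpha_i$ owned by player $i\bmod2$ with priority $2k+i+1$; $\beta_i$ owned by player $i\bmod 2$ with priority $i$; $\gamma_i$ owned by player $(i+1)\bmod2$ with priority $i$. Moves: $\alpha_i\to\beta_i$ only; $\beta_i\to\gamma_i$ and, if $i>0$, $\beta_i\to\alpha_{i-1}$; $\gamma_i\to\gamma_i$, $\gamma_i\to\beta_i$ and, if $i<2k$, $\gamma_i\to\alpha_{i+1}$. A game $G$ is a core extension of $G^C_k$ if, with $P$ the set of positions of $G$ not in $G^C_k$: (i) the restriction of $G$ to the positions of $G^C_k$ equals $G^C_k$; (ii)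 $\mathrm{pr}(v)<\mathrm{pr}(\alpha_0)$ for all $v\in P$; (iii) no $\alpha_i$ or $\beta_i$ has a move to or from a position of $P$; (iv) for every $i\in[0,2k]$ and $v\in P$ with $(\gamma_i,v)\in E$: $v$ is owned by player $i\bmod2$, $(v,\gamma_i)\in E$, and $\mathrm{pr}(v)\le i$. A worst-case family is a family $\{G_k\}_{k\ge1}$ with each $G_k$ a core extension of $G^C_k$. Induced subgame tree for fixed $k$: games $G_w$ ($w\in\{L,R\}^{\le k}$) and $G'_w$ ($w\in\{L,R\}^{\le k+1}$, $w\ne\varepsilon$), with $G_\varepsilon=G_k$ and, for $z_w=2(k-|w|)$: $G'_{wL}=G_w\setminus\mathrm{Attr}^1_{G_w}(\{\alpha_{z_w}\})$; $G'_{wR}=G_w\setminus\mathrm{Attr}^0_{G_w}(W^0(G'_{wL}))$; and, for $w\ne\varepsilon$, $G_w=G'_w\setminus \mathrm{Attr}^0_{G'_w}(\{\alpha_{z_w+1}\})$. -}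

module Defs where

open import Data.Nat using (ℕ; zero; suc; _+_; _*_; _∸_; _≤_; _<_)
open import Data.Nat.Base using (_%_)
open import Data.Fin using (Fin; toℕ)
open import Data.Sum using (_⊎_; inj₁; inj₂)
open import Data.Product using (Σ; ∃; _×_; _,_)
open import Data.List using (List; map; upTo)
open import Relation.Binary.PropositionalEquality using (_≡_; _≢_)
open import Relation.Nullary using (¬_)
open import Data.Unit using (⊤)

data Player : Set where
  P0 P1 : Player

playerOf : ℕ → Player
playerOf zero          = P0
playerOf (suc zero)    = P1
playerOf (suc (suc i)) = playerOf i

-- Parity games on a position type V (finiteness: V will be instantiated
-- by a finite type below).  Moves are a relation, required left-total.

record Game (V : Set) : Set₁ where
  field
    owner : V → Player
    pr    : V → ℕ
    E     : V → V → Set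
    total : ∀ v → ∃ λ w → E v w

-- subsets of positions; a subgame of G is determined by its set of positions
Subset : Set → Set₁
Subset V = V → Set

SameSet : {V : Set} → Subset V → Subset V → Set
SameSet A B = ∀ v → (A v → B v) × (B v → A v)

_∖_ : {V : Set} → Subset V → Subset V → Subset V
(S ∖ A) v = S v × ¬ A v

module _ {V : Set} (G : Game V) where
  open Game G

  data Attr (p : Player) (S X : Subset V) : V → Set where
    base : ∀ {v} → S v → X v → Attr p S X v
    own  : ∀ {v} w → S v → owner v ≡ p → E v w → S w → Attr p S X w → Attr p S X v
    opp  : ∀ {v} → S v → owner v ≢ p →
           (∀ w → E v w → S w → Attr p S X w) → Attr p S X v

  record Play (S : Subset V) (v : V) (ρ : ℕ → V) : Set where
    field
      start : ρ 0 ≡ v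
      inS   : ∀ i → S (ρ i)
      step  : ∀ i → E (ρ i) (ρ (suc i))

  history : (ℕ → V) → ℕ → List V
  history ρ i = map ρ (upTo i)

  Strategy : Set
  Strategy = List V → V → V

  Legal : Player → Subset V → Strategy → Set
  Legal p S σ = ∀ h u → S u → owner u ≡ p → S (σ h u) × E u (σ h u)

  Consistent : Player → Strategy → (ℕ → V) → Set
  Consistent p σ ρ = ∀ i → owner (ρ i) ≡ p → ρ (suc i) ≡ σ (history ρ i) (ρ i)

  data Even : ℕ → Set where
    ev0 : Even 0
    ev2 : ∀ {n} → Even n → Even (suc (suc n))

  winsParity : Player → ℕ → Set
  winsParity P0 n = Even n
  winsParity P1 n = ¬ Even n

  Wins : Player → (ℕ → V) → Set
  Wins p ρ = Σ ℕ λ q → winsParity p q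
           × (∀ N → Σ ℕ λ m → N ≤ m × pr (ρ m) ≡ q)
           × (Σ ℕ λ N → ∀ m → N ≤ m → pr (ρ m) ≤ q)

  W : Player → Subset V → Subset V
  W p S v = S v × Σ Strategy λ σ → Legal p S σ ×
            (∀ ρ → Play S v ρ → Consistent p σ ρ → Wins p ρ)

data Kind : Set where
  α β γ : Kind

CorePos : ℕ → Set
CorePos k = Kind × Fin (suc (2 * k))

coreOwner : (k : ℕ) → CorePos k → Player
coreOwner k (α , i) = playerOf (toℕ i)
coreOwner k (β , i) = playerOf (toℕ i)
coreOwner k (γ , i) = playerOf (suc (toℕ i))

corePr : (k : ℕ) → CorePos k → ℕ
corePr k (α , i) = 2 * k + toℕ i + 1
corePr k (β , i) = toℕ i
corePr k (γ , i) = toℕ i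

data CoreE (k : ℕ) : CorePos k → CorePos k → Set where
  αβ : ∀ i → CoreE k (α , i) (β , i)
  βγ : ∀ i → CoreE k (β , i) (γ , i)
  βα : ∀ i j → suc (toℕ j) ≡ toℕ i → CoreE k (β , i) (α , j)
  γγ : ∀ i → CoreE k (γ , i) (γ , i)
  γβ : ∀ i → CoreE k (γ , i) (β , i)
  γα : ∀ i j → suc (toℕ i) ≡ toℕ j → CoreE k (γ , i) (α , j)

-- Core extensions: positions of G are those of G^C_k (inj₁) plus a finite
-- set P = Fin m of further positions (inj₂).

ExtPos : ℕ → ℕ → Set
ExtPos k m = CorePos k ⊎ Fin m

record IsCoreExtension (k m : ℕ) (G : Game (ExtPos k m)) : Set where
  open Game G
  field
    ownerCore : ∀ c → owner (inj₁ c) ≡ coreOwner k c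
    prCore    : ∀ c → pr (inj₁ c) ≡ corePr k c
    moveCore  : ∀ c d → (E (inj₁ c) (inj₁ d) → CoreE k c d) × (CoreE k c d → E (inj₁ c) (inj₁ d))
    prP       : ∀ v → pr (inj₂ v) < corePr k (α , Fin.zero)
    noαout    : ∀ i v → ¬ E (inj₁ (α , i)) (inj₂ v)
    noαin     : ∀ i v → ¬ E (inj₂ v) (inj₁ (α , i))
    noβout    : ∀ i v → ¬ E (inj₁ (β , i)) (inj₂ v)
    noβin     : ∀ i v → ¬ E (inj₂ v) (inj₁ (β , i))
    γP        : ∀ i v → E (inj₁ (γ , i)) (inj₂ v) →
                owner (inj₂ v) ≡ playerOf (toℕ i) × E (inj₂ v) (inj₁ (γ , i)) × pr (inj₂ v) ≤ toℕ i

data Dir : Set where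
  L R : Dir

data Word : Set where
  ε   : Word
  _▹_ : Word → Dir → Word

len : Word → ℕ
len ε       = 0
len (w ▹ _) = suc (len w)

module Tree (k m : ℕ) (G : Game (ExtPos k m)) where

  alphaAt : ℕ → Subset (ExtPos k m)
  alphaAt z v = Σ (Fin (suc (2 * k))) λ i → v ≡ inj₁ (α , i) × toℕ i ≡ z

  full : Subset (ExtPos k m)
  full _ = ⊤

  z : Word → ℕ
  z w = 2 * (k ∸ len w)

  mutual
    Gw : Word → Subset (ExtPos k m)
    Gw ε       = full
    Gw (w ▹ d) = G'w w d ∖ Attr G P0 (G'w w d) (alphaAt (suc (z (w ▹ d))))

    G'w : Word → Dir → Subset (ExtPos k m)
    G'w w L = G'L w
    G'w w R = Gw w ∖ Attr G P0 (Gw w) (W G P0 (G'L w))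

    G'L : Word → Subset (ExtPos k m)
    G'L w = Gw w ∖ Attr G P1 (Gw w) (alphaAt (z w))

  data Node : Set where
    gN  : Word → Node
    g'N : Word → Dir → Node

  InTree : Node → Set
  InTree (gN w)    = len w ≤ k
  InTree (g'N w d) = len (w ▹ d) ≤ suc k

  game : Node → Subset (ExtPos k m)
  game (gN w)    = Gw w
  game (g'N w d) = G'w w d

module Submission where

-- The games of the tree are told apart by two invariants, proved together by
-- induction along the words.  Height: G_w contains α_i exactly for i ≤ z_w and
-- G'_{wd} exactly for i < z_w, together with every core position of lower
-- index; as z_w = 2(k − |w|) is even, the height determines |w| and whether the
-- game is a G or a G'.  Markers: if u ▹ d is a prefix of w, the position
-- γ_{z_u − 1} lies in the game iff d = L, so two games of the same height differ
-- at the first letter where their words differ.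
--
-- Attractors are kept small by traps: low core positions from which the
-- attracting player cannot climb, and single columns {β_i, γ_i} with the
-- positions of P next to γ_i.  For G'_{wR} one needs W^0(G'_{wL}): player 0
-- wins at the top column by returning to γ_{z_w}, whose priority is even, and
-- loses everywhere below it, since player 1, by always climbing, forces the play
-- into a column whose γ has odd priority.  Finally there are 2^{k+1} − 1 words
-- of length ≤ k and three games per word.

open import Defs
open import Data.Nat using (ℕ; zero; suc; pred; _+_; _*_; _∸_; _^_; _≤_; _<_; z≤n; s≤s; _≟_; _≤?_; _<?_; ≢-nonZero; >-nonZero)
open import Data.Nat.Properties
open import Data.Fin using (Fin; toℕ; fromℕ<; remQuot; combine) renaming (zero to fz; suc to fs)
open import Data.Fin.Properties using (toℕ-fromℕ<; toℕ-injective; toℕ<n; remQuot-combine; combine-remQuot)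
open import Data.Sum using (_⊎_; inj₁; inj₂)
open import Data.Product using (Σ; ∃; _×_; _,_; proj₁; proj₂)
open import Data.List using (List; []; _∷_; map; upTo; _∷ʳ_; _++_)
open import Data.List.Properties using (map-++; upTo-∷ʳ)
open import Data.Unit using (tt)
open import Data.Empty using (⊥; ⊥-elim)
open import Effect.Monad using (RawMonad)
open import Level using (0ℓ)
open import Relation.Nullary using (¬_; Dec; yes; no)
open import Relation.Nullary.Negation using (¬¬-Monad)
open import Relation.Nullary.Decidable using (¬¬-excluded-middle)
open import Relation.Binary.PropositionalEquality
open import Relation.Binary.Definitions using (tri<; tri≈; tri>)

open RawMonad (¬¬-Monad {0ℓ}) using (_>>=_; pure)

opponent : Player → Player
opponent P0 = P1
opponent P1 = P0

opponent-involutive : ∀ p → opponent (opponent p) ≡ p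
opponent-involutive P0 = refl
opponent-involutive P1 = refl

opponent-≢ : ∀ p → opponent p ≢ p
opponent-≢ P0 ()
opponent-≢ P1 ()

P0≢P1 : P0 ≢ P1
P0≢P1 ()

≢P0⇒≡P1 : ∀ {p} → p ≢ P0 → p ≡ P1
≢P0⇒≡P1 {P0} p≢P0 = ⊥-elim (p≢P0 refl)
≢P0⇒≡P1 {P1} _ = refl

_≟ᴾ_ : (p q : Player) → Dec (p ≡ q)
P0 ≟ᴾ P0 = yes refl
P0 ≟ᴾ P1 = no λ ()
P1 ≟ᴾ P0 = no λ ()
P1 ≟ᴾ P1 = yes refl

playerOf-suc : ∀ n → playerOf (suc n) ≡ opponent (playerOf n)
playerOf-suc zero = refl
playerOf-suc (suc zero) = refl
playerOf-suc (suc (suc n)) = playerOf-suc n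

playerOf-suc-≢ : ∀ n → playerOf (suc n) ≢ playerOf n
playerOf-suc-≢ n e = opponent-≢ (playerOf n) (trans (sym (playerOf-suc n)) e)

playerOf-succ : ∀ n {p} → playerOf n ≡ p → playerOf (suc n) ≡ opponent p
playerOf-succ n e = trans (playerOf-suc n) (cong opponent e)

playerOf-pred : ∀ n {p} → playerOf (suc n) ≡ p → playerOf n ≡ opponent p
playerOf-pred n e =
  trans (sym (opponent-involutive (playerOf n))) (cong opponent (trans (sym (playerOf-suc n)) e))

playerOf-2*+ : ∀ n j → playerOf (2 * n + j) ≡ playerOf j
playerOf-2*+ zero j = refl
playerOf-2*+ (suc n) j rewrite +-suc n (n + 0) = playerOf-2*+ n j

playerOf-2* : ∀ n → playerOf (2 * n) ≡ P0
playerOf-2* n = trans (cong playerOf (sym (+-identityʳ (2 * n)))) (playerOf-2*+ n 0)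

Even⇒playerOf≡P0 : ∀ {V} {G : Game V} {n} → Even G n → playerOf n ≡ P0
Even⇒playerOf≡P0 ev0 = refl
Even⇒playerOf≡P0 (ev2 e) = Even⇒playerOf≡P0 e

playerOf≡P0⇒Even : ∀ {V} {G : Game V} n → playerOf n ≡ P0 → Even G n
playerOf≡P0⇒Even zero _ = ev0
playerOf≡P0⇒Even (suc zero) ()
playerOf≡P0⇒Even (suc (suc n)) e = ev2 (playerOf≡P0⇒Even n e)

-- Holds for finite X; it assembles classically chosen moves into a strategy.
DoubleNegationShift : Set → Set₁
DoubleNegationShift X = ∀ (P : X → Set) → (∀ x → ¬ ¬ P x) → ¬ ¬ (∀ x → P x)

dns-Fin : ∀ n → DoubleNegationShift (Fin n)
dns-Fin zero P h k = k λ ()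
dns-Fin (suc n) P h k = h fz λ p₀ → dns-Fin n (λ x → P (fs x)) (λ x → h (fs x))
  λ f → k λ { fz → p₀ ; (fs x) → f x }

dns-⊎ : ∀ {X Y} → DoubleNegationShift X → DoubleNegationShift Y → DoubleNegationShift (X ⊎ Y)
dns-⊎ dx dy P h k = dx (λ x → P (inj₁ x)) (λ x → h (inj₁ x)) λ f →
  dy (λ y → P (inj₂ y)) (λ y → h (inj₂ y)) λ g → k λ { (inj₁ x) → f x ; (inj₂ y) → g y }

dns-× : ∀ {X Y} → DoubleNegationShift X → DoubleNegationShift Y → DoubleNegationShift (X × Y)
dns-× dx dy P h k = dx (λ x → ∀ y → P (x , y)) (λ x → dy (λ y → P (x , y)) (λ y → h (x , y)))
  λ f → k λ { (x , y) → f x y }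

dns-Kind : DoubleNegationShift Kind
dns-Kind P h k = h α λ a → h β λ b → h γ λ c → k λ { α → a ; β → b ; γ → c }

dns-ExtPos : ∀ k m → DoubleNegationShift (ExtPos k m)
dns-ExtPos k m = dns-⊎ (dns-× dns-Kind (dns-Fin _)) (dns-Fin m)

¬¬-→ : ∀ {X Y : Set} → (X → ¬ ¬ Y) → ¬ ¬ (X → Y)
¬¬-→ h k = k λ x → ⊥-elim (h x λ y → k λ _ → y)

module GameFacts {V : Set} (G : Game V) where
  open Game G

  record IsTrap (p : Player) (S X T : Subset V) : Set where
    field
      avoids : ∀ v → T v → S v → ¬ X v
      closed : ∀ v → T v → S v → owner v ≡ p → ∀ w → E v w → S w → T w
      escape : ∀ v → T v → S v → owner v ≢ p → ∃ λ w → E v w × S w × T w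

  trap⇒¬Attr : ∀ {p S X T} → IsTrap p S X T → ∀ v → T v → ¬ Attr G p S X v
  trap⇒¬Attr trap v tv (base sv xv) = IsTrap.avoids trap v tv sv xv
  trap⇒¬Attr trap v tv (own w sv o e sw a) = trap⇒¬Attr trap w (IsTrap.closed trap v tv sv o w e sw) a
  trap⇒¬Attr trap v tv (opp sv o f) with IsTrap.escape trap v tv sv o
  ... | w , e , sw , tw = trap⇒¬Attr trap w tw (f w e sw)

  -- Only doubly negated: an opponent position outside an attractor has some
  -- successor outside it, but which one cannot be computed.
  Total : Subset V → Set
  Total S = ∀ v → S v → ¬ ¬ (∃ λ w → E v w × S w)

  Total-∖Attr : DoubleNegationShift V → ∀ {S X p} → Total S → Total (S ∖ Attr G p S X)
  Total-∖Attr dns {S} {X} {p} total-S v (sv , v∉A) k with owner v ≟ᴾ p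
  ... | yes o = total-S v sv λ { (w , e , sw) → k (w , e , sw , λ w∈A → v∉A (own w sv o e sw w∈A)) }
  ... | no o = dns (λ w → E v w → S w → Attr G p S X w)
                   (λ w → ¬¬-→ λ e → ¬¬-→ λ sw w∉A → k (w , e , sw , w∉A))
                   (λ all-attracted → v∉A (opp sv o all-attracted))

  -- τ p c is player 1's move at c when the previous position was p.
  module PlayAgainst (σ : Strategy G) (τ : V → V → V) (v₀ prev₀ : V) where

    record State : Set where
      constructor state
      field
        hist : List V
        prev cur : V
    open State

    byOwner : Player → V → V → V
    byOwner P0 x _ = x
    byOwner P1 _ y = y

    next : State → State
    next (state h p c) = state (h ∷ʳ c) c (byOwner (owner c) (σ h c) (τ p c))

    run : ℕ → State
    run zero = state [] prev₀ v₀
    run (suc t) = next (run t)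

    ρ : ℕ → V
    ρ t = cur (run t)

    previous : ℕ → V
    previous t = prev (run t)

    hist-run : ∀ t → hist (run t) ≡ history G ρ t
    hist-run zero = refl
    hist-run (suc t) = begin
        hist (run t) ∷ʳ ρ t           ≡⟨ cong (_∷ʳ ρ t) (hist-run t) ⟩
        map ρ (upTo t) ++ (ρ t ∷ [])  ≡⟨ map-++ ρ (upTo t) (t ∷ []) ⟨
        map ρ (upTo t ∷ʳ t)           ≡⟨ cong (map ρ) (upTo-∷ʳ t) ⟩
        map ρ (upTo (suc t))          ∎
      where open ≡-Reasoning

    step-P0 : ∀ t → owner (ρ t) ≡ P0 → ρ (suc t) ≡ σ (history G ρ t) (ρ t)
    step-P0 t o with owner (ρ t)
    step-P0 t refl | .P0 = cong (λ h → σ h (ρ t)) (hist-run t)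

    step-P1 : ∀ t {c} → ρ t ≡ c → owner c ≡ P1 → ρ (suc t) ≡ τ (previous t) c
    step-P1 t refl o with owner (ρ t)
    step-P1 t refl refl | .P1 = refl

    consistent : Consistent G P0 σ ρ
    consistent = step-P0

    module Invariant (S : Subset V) (legal : Legal G P0 S σ) (I : V → V → Set)
      (I-start : I prev₀ v₀)
      (I⇒S : ∀ p c → I p c → S c)
      (I-σ : ∀ p c → I p c → owner c ≡ P0 → ∀ w → E c w → S w → I c w)
      (I-τ : ∀ p c → I p c → owner c ≡ P1 → E c (τ p c) × I c (τ p c)) where

      step : ∀ t → I (previous t) (ρ t) → E (ρ t) (ρ (suc t)) × I (ρ t) (ρ (suc t))
      step t it = by (owner (ρ t)) refl
        where
        by : ∀ o → owner (ρ t) ≡ o → E (ρ t) (ρ (suc t)) × I (ρ t) (ρ (suc t))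
        by P0 o with legal (history G ρ t) (ρ t) (I⇒S _ _ it) o | step-P0 t o
        ... | sw , e | ρ≡ rewrite ρ≡ = e , I-σ _ _ it o _ e sw
        by P1 o rewrite step-P1 t refl o = I-τ _ _ it o

      invariant : ∀ t → I (previous t) (ρ t)
      invariant zero = I-start
      invariant (suc t) = proj₂ (step t (invariant t))

      moves : ∀ t → E (ρ t) (ρ (suc t))
      moves t = proj₁ (step t (invariant t))

      play : Play G S v₀ ρ
      play = record { start = refl ; inS = λ t → I⇒S _ _ (invariant t) ; step = moves }

SameSet-sym : ∀ {V} {S T : Subset V} → SameSet S T → SameSet T S
SameSet-sym S≈T v = proj₂ (S≈T v) , proj₁ (S≈T v)

≡⇒SameSet : ∀ {V} {S T : Subset V} → S ≡ T → SameSet S T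
≡⇒SameSet refl v = (λ v∈S → v∈S) , (λ v∈S → v∈S)

data _≼_ : Word → Word → Set where
  ≼-refl : ∀ {w} → w ≼ w
  ≼-step : ∀ {u w d} → u ≼ w → u ≼ (w ▹ d)

≼⇒len≤ : ∀ {u w} → u ≼ w → len u ≤ len w
≼⇒len≤ ≼-refl = ≤-refl
≼⇒len≤ (≼-step u≼w) = m≤n⇒m≤1+n (≼⇒len≤ u≼w)

_≟ᴰ_ : (d d′ : Dir) → Dec (d ≡ d′)
L ≟ᴰ L = yes refl
L ≟ᴰ R = no λ ()
R ≟ᴰ L = no λ ()
R ≟ᴰ R = yes refl

▹-injective : ∀ {w w′ d d′} → (w ▹ d) ≡ (w′ ▹ d′) → w ≡ w′ × d ≡ d′
▹-injective refl = refl , refl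

_≟ᵂ_ : (w w′ : Word) → Dec (w ≡ w′)
ε ≟ᵂ ε = yes refl
ε ≟ᵂ (_ ▹ _) = no λ ()
(_ ▹ _) ≟ᵂ ε = no λ ()
(w ▹ d) ≟ᵂ (w′ ▹ d′) with w ≟ᵂ w′ | d ≟ᴰ d′
... | yes refl | yes refl = yes refl
... | no w≢w′ | _ = no λ e → w≢w′ (proj₁ (▹-injective e))
... | yes _ | no d≢d′ = no λ e → d≢d′ (proj₂ (▹-injective e))

first-difference : ∀ w w′ → len w ≡ len w′ → w ≢ w′ →
  ∃ λ u → ∃ λ d → ∃ λ d′ → d ≢ d′ × (u ▹ d) ≼ w × (u ▹ d′) ≼ w′
first-difference ε ε _ ε≢ε = ⊥-elim (ε≢ε refl)
first-difference (w ▹ d) (w′ ▹ d′) len≡ w▹d≢w′▹d′ with w ≟ᵂ w′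
... | yes refl = w , d , d′ , (λ d≡d′ → w▹d≢w′▹d′ (cong (w ▹_) d≡d′)) , ≼-refl , ≼-refl
... | no w≢w′ with first-difference w w′ (suc-injective len≡) w≢w′
... | u , e , e′ , e≢e′ , p , p′ = u , e , e′ , e≢e′ , ≼-step p , ≼-step p′

wordCount : ℕ → ℕ
wordCount zero = 1
wordCount (suc n) = suc (2 * wordCount n)

wordCount≡ : ∀ n → wordCount n ≡ 2 ^ (n + 1) ∸ 1
wordCount≡ n = trans (sym (m+n∸n≡m (wordCount n) 1)) (cong (_∸ 1) (wordCount+1 n))
  where
  wordCount+1 : ∀ n → wordCount n + 1 ≡ 2 ^ (n + 1)
  wordCount+1 zero = refl
  wordCount+1 (suc n) = begin
    suc (2 * wordCount n) + 1  ≡⟨ +-comm (suc (2 * wordCount n)) 1 ⟩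
    2 + 2 * wordCount n        ≡⟨ *-distribˡ-+ 2 1 (wordCount n) ⟨
    2 * (1 + wordCount n)      ≡⟨ cong (2 *_) (trans (+-comm 1 (wordCount n)) (wordCount+1 n)) ⟩
    2 * 2 ^ (n + 1)            ∎
    where open ≡-Reasoning

dirToFin : Dir → Fin 2
dirToFin L = fz
dirToFin R = fs fz

finToDir : Fin 2 → Dir
finToDir fz = L
finToDir (fs _) = R

finToDir-dirToFin : ∀ d → finToDir (dirToFin d) ≡ d
finToDir-dirToFin L = refl
finToDir-dirToFin R = refl

dirToFin-finToDir : ∀ i → dirToFin (finToDir i) ≡ i
dirToFin-finToDir fz = refl
dirToFin-finToDir (fs fz) = refl

-- Words of length ≤ n+1 are ε or (a word of length ≤ n) ▹ (a letter).
toWord : ∀ n → Fin (wordCount n) → Word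
toWord zero _ = ε
toWord (suc n) fz = ε
toWord (suc n) (fs i) = toWord n (proj₂ (remQuot {2} (wordCount n) i)) ▹ finToDir (proj₁ (remQuot {2} (wordCount n) i))

fromWord : ∀ n → Word → Fin (wordCount n)
fromWord zero _ = fz
fromWord (suc n) ε = fz
fromWord (suc n) (w ▹ d) = fs (combine (dirToFin d) (fromWord n w))

len-toWord : ∀ n i → len (toWord n i) ≤ n
len-toWord zero _ = z≤n
len-toWord (suc n) fz = z≤n
len-toWord (suc n) (fs i) = s≤s (len-toWord n _)

toWord-fromWord : ∀ n w → len w ≤ n → toWord n (fromWord n w) ≡ w
toWord-fromWord zero ε _ = refl
toWord-fromWord (suc n) ε _ = refl
toWord-fromWord (suc n) (w ▹ d) (s≤s len≤n) = begin
  toWord (suc n) (fs (combine (dirToFin d) (fromWord n w)))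
    ≡⟨ cong (λ p → toWord n (proj₂ p) ▹ finToDir (proj₁ p)) (remQuot-combine {2} {wordCount n} (dirToFin d) (fromWord n w)) ⟩
  toWord n (fromWord n w) ▹ finToDir (dirToFin d)
    ≡⟨ cong₂ _▹_ (toWord-fromWord n w len≤n) (finToDir-dirToFin d) ⟩
  w ▹ d ∎
  where open ≡-Reasoning

fromWord-toWord : ∀ n i → fromWord n (toWord n i) ≡ i
fromWord-toWord zero fz = refl
fromWord-toWord (suc n) fz = refl
fromWord-toWord (suc n) (fs i) = cong fs (begin
  combine (dirToFin (finToDir d)) (fromWord n (toWord n j))  ≡⟨ cong₂ combine (dirToFin-finToDir d) (fromWord-toWord n j) ⟩
  combine d j                                                ≡⟨ combine-remQuot {2} (wordCount n) i ⟩
  i                                                          ∎)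
  where
  open ≡-Reasoning
  d = proj₁ (remQuot {2} (wordCount n) i)
  j = proj₂ (remQuot {2} (wordCount n) i)

module NodeEnumeration (k m : ℕ) (G : Game (ExtPos k m)) where
  open Tree k m G

  nodeOf : Fin 3 → Word → Node
  nodeOf fz w = gN w
  nodeOf (fs fz) w = g'N w L
  nodeOf (fs (fs fz)) w = g'N w R

  nodeOf-injective : ∀ r w r′ w′ → nodeOf r w ≡ nodeOf r′ w′ → r ≡ r′ × w ≡ w′
  nodeOf-injective fz _ fz _ refl = refl , refl
  nodeOf-injective (fs fz) _ (fs fz) _ refl = refl , refl
  nodeOf-injective (fs (fs fz)) _ (fs (fs fz)) _ refl = refl , refl
  nodeOf-injective fz _ (fs fz) _ ()
  nodeOf-injective fz _ (fs (fs fz)) _ ()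
  nodeOf-injective (fs fz) _ fz _ ()
  nodeOf-injective (fs fz) _ (fs (fs fz)) _ ()
  nodeOf-injective (fs (fs fz)) _ fz _ ()
  nodeOf-injective (fs (fs fz)) _ (fs fz) _ ()

  node : Fin (3 * wordCount k) → Node
  node i = nodeOf (proj₁ (remQuot {3} (wordCount k) i)) (toWord k (proj₂ (remQuot {3} (wordCount k) i)))

  nodeOf-InTree : ∀ r w → len w ≤ k → InTree (nodeOf r w)
  nodeOf-InTree fz _ len≤k = len≤k
  nodeOf-InTree (fs fz) _ len≤k = s≤s len≤k
  nodeOf-InTree (fs (fs fz)) _ len≤k = s≤s len≤k

  node-InTree : ∀ i → InTree (node i)
  node-InTree i = nodeOf-InTree _ _ (len-toWord k _)

  node-injective : ∀ i j → node i ≡ node j → i ≡ j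
  node-injective i j node-i≡node-j = begin
    i                                       ≡⟨ combine-remQuot {3} (wordCount k) i ⟨
    combine (proj₁ rᵢ) (proj₂ rᵢ)           ≡⟨ cong₂ combine (proj₁ same) wordᵢ≡wordⱼ ⟩
    combine (proj₁ rⱼ) (proj₂ rⱼ)           ≡⟨ combine-remQuot {3} (wordCount k) j ⟩
    j                                       ∎
    where
    open ≡-Reasoning
    rᵢ = remQuot {3} (wordCount k) i
    rⱼ = remQuot {3} (wordCount k) j
    same = nodeOf-injective (proj₁ rᵢ) _ (proj₁ rⱼ) _ node-i≡node-j
    wordᵢ≡wordⱼ : proj₂ rᵢ ≡ proj₂ rⱼ
    wordᵢ≡wordⱼ = trans (sym (fromWord-toWord k (proj₂ rᵢ)))
                        (trans (cong (fromWord k) (proj₂ same)) (fromWord-toWord k (proj₂ rⱼ)))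

  as-nodeOf : ∀ a → InTree a → ∃ λ r → ∃ λ w → len w ≤ k × nodeOf r w ≡ a
  as-nodeOf (gN w) len≤k = fz , w , len≤k , refl
  as-nodeOf (g'N w L) len≤k = fs fz , w , ≤-pred len≤k , refl
  as-nodeOf (g'N w R) len≤k = fs (fs fz) , w , ≤-pred len≤k , refl

  node-surjective : ∀ a → InTree a → ∃ λ i → node i ≡ a
  node-surjective a a∈T with as-nodeOf a a∈T
  ... | r , w , len≤k , refl = combine r (fromWord k w) , (begin
    node (combine r (fromWord k w))      ≡⟨ cong (λ p → nodeOf (proj₁ p) (toWord k (proj₂ p))) (remQuot-combine {3} {wordCount k} r (fromWord k w)) ⟩
    nodeOf r (toWord k (fromWord k w))   ≡⟨ cong (nodeOf r) (toWord-fromWord k w len≤k) ⟩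
    nodeOf r w                           ∎)
    where open ≡-Reasoning

  enumerate : (∀ a b → InTree a → InTree b → a ≢ b → ¬ SameSet (game a) (game b)) →
              ∀ {M} → 3 * wordCount k ≡ M →
              Σ (Fin M → Node) λ f → (∀ i → InTree (f i))
                × (∀ i j → i ≢ j → ¬ SameSet (game (f i)) (game (f j)))
                × (∀ a → InTree a → Σ (Fin M) λ i → SameSet (game a) (game (f i)))
  enumerate distinct refl =
    node , node-InTree ,
    (λ i j i≢j → distinct (node i) (node j) (node-InTree i) (node-InTree j) λ e → i≢j (node-injective i j e)) ,
    λ a a∈T → proj₁ (node-surjective a a∈T) , ≡⇒SameSet (cong game (sym (proj₂ (node-surjective a a∈T))))

module CoreExtension (k m : ℕ) (G : Game (ExtPos k m)) (ext : IsCoreExtension k m G) where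
  open Game G
  open IsCoreExtension ext
  open GameFacts G
  open Tree k m G

  V : Set
  V = ExtPos k m

  Idx : Set
  Idx = Fin (suc (2 * k))

  α[_] β[_] γ[_] : Idx → V
  α[ i ] = inj₁ (α , i)
  β[ i ] = inj₁ (β , i)
  γ[ i ] = inj₁ (γ , i)

  -- junk value fz outside [0, 2k]
  idx : ℕ → Idx
  idx n with n <? suc (2 * k)
  ... | yes n<2k+1 = fromℕ< n<2k+1
  ... | no _ = fz

  toℕ-idx : ∀ n → n ≤ 2 * k → toℕ (idx n) ≡ n
  toℕ-idx n n≤2k with n <? suc (2 * k)
  ... | yes n<2k+1 = toℕ-fromℕ< n<2k+1
  ... | no n≮2k+1 = ⊥-elim (n≮2k+1 (s≤s n≤2k))

  toℕ≤2k : ∀ (i : Idx) → toℕ i ≤ 2 * k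
  toℕ≤2k i = ≤-pred (toℕ<n i)

  move-αβ : ∀ i → E α[ i ] β[ i ]
  move-αβ i = proj₂ (moveCore _ _) (αβ i)
  move-βγ : ∀ i → E β[ i ] γ[ i ]
  move-βγ i = proj₂ (moveCore _ _) (βγ i)
  move-βα : ∀ i j → suc (toℕ j) ≡ toℕ i → E β[ i ] α[ j ]
  move-βα i j e = proj₂ (moveCore _ _) (βα i j e)
  move-γγ : ∀ i → E γ[ i ] γ[ i ]
  move-γγ i = proj₂ (moveCore _ _) (γγ i)
  move-γα : ∀ i j → suc (toℕ i) ≡ toℕ j → E γ[ i ] α[ j ]
  move-γα i j e = proj₂ (moveCore _ _) (γα i j e)

  moves-α : ∀ i w → E α[ i ] w → w ≡ β[ i ]
  moves-α i (inj₁ (κ , j)) e with proj₁ (moveCore (α , i) (κ , j)) e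
  ... | αβ .i = refl
  moves-α i (inj₂ q) e = ⊥-elim (noαout i q e)

  moves-β : ∀ i w → E β[ i ] w → w ≡ γ[ i ] ⊎ ∃ λ j → suc (toℕ j) ≡ toℕ i × w ≡ α[ j ]
  moves-β i (inj₁ (κ , j)) e with proj₁ (moveCore (β , i) (κ , j)) e
  ... | βγ .i = inj₁ refl
  ... | βα .i .j j+1≡i = inj₂ (j , j+1≡i , refl)
  moves-β i (inj₂ q) e = ⊥-elim (noβout i q e)

  data γMove (i : Idx) : V → Set where
    to-γ : γMove i γ[ i ]
    to-β : γMove i β[ i ]
    to-α : ∀ j → suc (toℕ i) ≡ toℕ j → γMove i α[ j ]
    to-extra : ∀ q → E γ[ i ] (inj₂ q) → γMove i (inj₂ q)

  moves-γ : ∀ i w → E γ[ i ] w → γMove i w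
  moves-γ i (inj₁ (κ , j)) e with proj₁ (moveCore (γ , i) (κ , j)) e
  ... | γγ .i = to-γ
  ... | γβ .i = to-β
  ... | γα .i .j i+1≡j = to-α j i+1≡j
  moves-γ i (inj₂ q) e = to-extra q e

  owner-α : ∀ i → owner α[ i ] ≡ playerOf (toℕ i)
  owner-α i = ownerCore (α , i)
  owner-β : ∀ i → owner β[ i ] ≡ playerOf (toℕ i)
  owner-β i = ownerCore (β , i)
  owner-γ : ∀ i → owner γ[ i ] ≡ playerOf (suc (toℕ i))
  owner-γ i = ownerCore (γ , i)

  pr-α : ∀ i → pr α[ i ] ≡ 2 * k + toℕ i + 1
  pr-α i = prCore (α , i)
  pr-β : ∀ i → pr β[ i ] ≡ toℕ i
  pr-β i = prCore (β , i)
  pr-γ : ∀ i → pr γ[ i ] ≡ toℕ i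
  pr-γ i = prCore (γ , i)

  pr-extra≤2k : ∀ q → pr (inj₂ q) ≤ 2 * k
  pr-extra≤2k q = ≤-pred (subst (pr (inj₂ q) <_) (trans (cong (_+ 1) (+-identityʳ (2 * k))) (+-comm (2 * k) 1)) (prP q))

  2k<pr-α : ∀ i → 2 * k < pr α[ i ]
  2k<pr-α i rewrite pr-α i | +-comm (2 * k + toℕ i) 1 = s≤s (m≤m+n (2 * k) (toℕ i))

  pr-α-suc : ∀ i j → suc (toℕ i) ≡ toℕ j → pr α[ j ] ≡ suc (pr α[ i ])
  pr-α-suc i j i+1≡j rewrite pr-α i | pr-α j | sym i+1≡j | +-suc (2 * k) (toℕ i) = refl

  playerOf-pr-α : ∀ i → playerOf (pr α[ i ]) ≡ playerOf (suc (toℕ i))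
  playerOf-pr-α i rewrite pr-α i | +-assoc (2 * k) (toℕ i) 1 | +-comm (toℕ i) 1 = playerOf-2*+ k (suc (toℕ i))

  extra-owner : ∀ i q → E γ[ i ] (inj₂ q) → owner (inj₂ q) ≡ playerOf (toℕ i)
  extra-owner i q e = proj₁ (γP i q e)
  extra-back : ∀ i q → E γ[ i ] (inj₂ q) → E (inj₂ q) γ[ i ]
  extra-back i q e = proj₁ (proj₂ (γP i q e))
  extra-pr : ∀ i q → E γ[ i ] (inj₂ q) → pr (inj₂ q) ≤ toℕ i
  extra-pr i q e = proj₂ (proj₂ (γP i q e))

  -- The first index is the previous position: positions of P in the column
  -- are entered only from γ_i, so moving back to the previous position
  -- returns to γ_i.
  data InColumn (i : Idx) : V → V → Set where
    at-γ : ∀ {p} → InColumn i p γ[ i ]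
    at-β : ∀ {p} → InColumn i p β[ i ]
    at-extra : ∀ q → E γ[ i ] (inj₂ q) → InColumn i γ[ i ] (inj₂ q)

  InColumn-pr : ∀ {i p c} → InColumn i p c → pr c ≤ toℕ i
  InColumn-pr {i} at-γ = ≤-reflexive (pr-γ i)
  InColumn-pr {i} at-β = ≤-reflexive (pr-β i)
  InColumn-pr {i} (at-extra q e) = extra-pr i q e

  γMove⇒InColumn : ∀ {i w} → γMove i w → (∀ j → suc (toℕ i) ≡ toℕ j → w ≢ α[ j ]) → InColumn i γ[ i ] w
  γMove⇒InColumn to-γ _ = at-γ
  γMove⇒InColumn to-β _ = at-β
  γMove⇒InColumn (to-α j i+1≡j) no-α = ⊥-elim (no-α j i+1≡j refl)
  γMove⇒InColumn (to-extra q e) _ = at-extra q e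

  data Below (p : Player) (b : ℕ) : V → Set where
    core : ∀ κ i → toℕ i < b → Below p b (inj₁ (κ , i))
    extra : ∀ i q → toℕ i < b → E γ[ i ] (inj₂ q) → owner (inj₂ q) ≢ p → Below p b (inj₂ q)

  -- p can leave only by climbing from some γ_i to α_{i+1}, which stuck forbids.
  module BelowTrap (p : Player) (b : ℕ) (S X : Subset V)
    (core⊆S : ∀ κ i → toℕ i < b → S (inj₁ (κ , i)))
    (stuck : ∀ (i : Idx) → playerOf (suc (toℕ i)) ≡ p → toℕ i < b → suc (toℕ i) < b)
    (avoids : ∀ v → Below p b v → S v → ¬ X v) where

    closed : ∀ v → Below p b v → S v → owner v ≡ p → ∀ w → E v w → S w → Below p b w
    closed .(α[ i ]) (core α i i<b) _ _ w e _ rewrite moves-α i w e = core β i i<b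
    closed .(β[ i ]) (core β i i<b) _ _ w e _ with moves-β i w e
    ... | inj₁ refl = core γ i i<b
    ... | inj₂ (j , j+1≡i , refl) = core α j (≤-trans (≤-reflexive j+1≡i) (<⇒≤ i<b))
    closed .(γ[ i ]) (core γ i i<b) _ o w e _ with moves-γ i w e
    ... | to-γ = core γ i i<b
    ... | to-β = core β i i<b
    ... | to-α j i+1≡j = core α j (subst (_< b) i+1≡j (stuck i (trans (sym (owner-γ i)) o) i<b))
    ... | to-extra q eq = extra i q i<b eq λ oq →
          playerOf-suc-≢ (toℕ i) (trans (trans (sym (owner-γ i)) o) (trans (sym oq) (extra-owner i q eq)))
    closed .(inj₂ q) (extra i q _ _ q≢p) _ o = ⊥-elim (q≢p o)

    escape : ∀ v → Below p b v → S v → owner v ≢ p → ∃ λ w → E v w × S w × Below p b w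
    escape .(α[ i ]) (core α i i<b) _ _ = β[ i ] , move-αβ i , core⊆S β i i<b , core β i i<b
    escape .(β[ i ]) (core β i i<b) _ _ = γ[ i ] , move-βγ i , core⊆S γ i i<b , core γ i i<b
    escape .(γ[ i ]) (core γ i i<b) _ _ = γ[ i ] , move-γγ i , core⊆S γ i i<b , core γ i i<b
    escape .(inj₂ q) (extra i q i<b e _) _ _ = γ[ i ] , extra-back i q e , core⊆S γ i i<b , core γ i i<b

    Below⇒¬Attr : ∀ v → Below p b v → ¬ Attr G p S X v
    Below⇒¬Attr = trap⇒¬Attr record { avoids = avoids ; closed = closed ; escape = escape }

  module ColumnTrap (p : Player) (j : Idx) (S X : Subset V)
    (γ-owner : playerOf (suc (toℕ j)) ≡ p)
    (γ∈S : S γ[ j ])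
    (no-α-above : ∀ i → suc (toℕ j) ≡ toℕ i → ¬ S α[ i ])
    (avoids : ∀ v → InColumn j γ[ j ] v → S v → ¬ X v) where

    closed : ∀ v → InColumn j γ[ j ] v → S v → owner v ≡ p → ∀ w → E v w → S w → InColumn j γ[ j ] w
    closed .(γ[ j ]) at-γ _ _ w e sw with moves-γ j w e
    ... | to-γ = at-γ
    ... | to-β = at-β
    ... | to-α i j+1≡i = ⊥-elim (no-α-above i j+1≡i sw)
    ... | to-extra q eq = at-extra q eq
    closed .(β[ j ]) at-β _ o _ _ _ =
      ⊥-elim (playerOf-suc-≢ (toℕ j) (trans γ-owner (trans (sym o) (owner-β j))))
    closed .(inj₂ q) (at-extra q eq) _ o _ _ _ =
      ⊥-elim (playerOf-suc-≢ (toℕ j) (trans γ-owner (trans (sym o) (extra-owner j q eq))))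

    escape : ∀ v → InColumn j γ[ j ] v → S v → owner v ≢ p → ∃ λ w → E v w × S w × InColumn j γ[ j ] w
    escape .(γ[ j ]) at-γ _ o = ⊥-elim (o (trans (owner-γ j) γ-owner))
    escape .(β[ j ]) at-β _ _ = γ[ j ] , move-βγ j , γ∈S , at-γ
    escape .(inj₂ q) (at-extra q eq) _ _ = γ[ j ] , extra-back j q eq , γ∈S , at-γ

    Column⇒¬Attr : ∀ v → InColumn j γ[ j ] v → ¬ Attr G p S X v
    Column⇒¬Attr = trap⇒¬Attr record { avoids = avoids ; closed = closed ; escape = escape }

  γ∉Attr-of-nonowner : ∀ p j (S X : Subset V) → owner γ[ j ] ≢ p → ¬ X γ[ j ] → ¬ Attr G p S X γ[ j ]
  γ∉Attr-of-nonowner p j S X o γ∉X = trap⇒¬Attr {T = _≡ γ[ j ]}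
    (record { avoids = λ { _ refl _ → γ∉X }
            ; closed = λ { _ refl _ o′ → ⊥-elim (o o′) }
            ; escape = λ { _ refl sv _ → γ[ j ] , move-γγ j , sv , refl } })
    γ[ j ] refl

  Column∉alphaAt : ∀ j n v → InColumn j γ[ j ] v → ¬ alphaAt n v
  Column∉alphaAt j n .(γ[ j ]) at-γ (i , () , _)
  Column∉alphaAt j n .(β[ j ]) at-β (i , () , _)
  Column∉alphaAt j n .(inj₂ q) (at-extra q x) (i , () , _)

  Below∉alphaAt : ∀ p b v → Below p b v → ¬ alphaAt b v
  Below∉alphaAt p b .(inj₁ (κ , i)) (core κ i i<b) (i′ , refl , i≡b) = <-irrefl i≡b i<b
  Below∉alphaAt p b .(inj₂ q) (extra i q _ _ _) (_ , () , _)

  γ∉alphaAt : ∀ n j → ¬ alphaAt n γ[ j ]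
  γ∉alphaAt n j (i , () , _)

  climb : V → V → V
  climb _ (inj₁ (α , i)) = β[ i ]
  climb _ (inj₁ (β , i)) = γ[ i ]
  climb _ (inj₁ (γ , i)) = α[ idx (suc (toℕ i)) ]
  climb previous (inj₂ _) = previous

  ClimbMove : V → V → V → Set
  ClimbMove p c c′ = E c c′ × (owner c ≡ P1 → c′ ≡ climb p c)

  -- In a column whose γ belongs to player 0, all other positions belong to
  -- player 1, who climbs back to γ at once.
  module OddColumn (i : Idx) (γ-P0 : playerOf (suc (toℕ i)) ≡ P0) where

    β-P1 : owner β[ i ] ≡ P1
    β-P1 = trans (owner-β i) (playerOf-pred (toℕ i) γ-P0)

    extra-P1 : ∀ q → E γ[ i ] (inj₂ q) → owner (inj₂ q) ≡ P1
    extra-P1 q e = trans (extra-owner i q e) (playerOf-pred (toℕ i) γ-P0)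

    column-step : ∀ {p c c′} → InColumn i p c → ClimbMove p c c′ →
                  (∀ j → suc (toℕ i) ≡ toℕ j → c′ ≢ α[ j ]) → InColumn i c c′
    column-step at-γ (e , _) no-α = γMove⇒InColumn (moves-γ i _ e) no-α
    column-step at-β (_ , climbs) _ rewrite climbs β-P1 = at-γ
    column-step (at-extra q e) (_ , climbs) _ rewrite climbs (extra-P1 q e) = at-γ

    column-returns : ∀ {p c c′} → InColumn i p c → ClimbMove p c c′ → c ≡ γ[ i ] ⊎ c′ ≡ γ[ i ]
    column-returns at-γ _ = inj₁ refl
    column-returns at-β (_ , climbs) = inj₂ (climbs β-P1)
    column-returns (at-extra q e) (_ , climbs) = inj₂ (climbs (extra-P1 q e))

    module _ (ρ prev : ℕ → V) (climbs : ∀ t → ClimbMove (prev t) (ρ t) (ρ (suc t)))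
             (prev-suc : ∀ t → prev (suc t) ≡ ρ t) where

      -- Trapped in the column, the play sees γ_i infinitely often and nothing
      -- of priority above the odd number i.
      trapped-in-column⇒¬Wins : ∀ s₀ → InColumn i (prev s₀) (ρ s₀) →
        (∀ t → s₀ ≤ t → ∀ j → suc (toℕ i) ≡ toℕ j → ρ (suc t) ≢ α[ j ]) → ¬ Wins G P0 ρ
      trapped-in-column⇒¬Wins s₀ start no-α (q , even-q , often , N , bounded) =
        P0≢P1 (trans (sym (Even⇒playerOf≡P0 even-q′)) (playerOf-pred (toℕ i) γ-P0))
        where
        stays : ∀ d → InColumn i (prev (s₀ + d)) (ρ (s₀ + d))
        stays zero rewrite +-identityʳ s₀ = start
        stays (suc d) rewrite +-suc s₀ d | prev-suc (s₀ + d) =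
          column-step (stays d) (climbs (s₀ + d)) (no-α (s₀ + d) (m≤m+n s₀ d))

        t : ℕ
        t = s₀ + N

        γ-seen : ∃ λ s → N ≤ s × ρ s ≡ γ[ i ]
        γ-seen with column-returns (stays N) (climbs t)
        ... | inj₁ e = t , m≤n+m N s₀ , e
        ... | inj₂ e = suc t , ≤-trans (m≤n+m N s₀) (n≤1+n t) , e

        i≤q : toℕ i ≤ q
        i≤q with γ-seen
        ... | s , N≤s , e = subst (_≤ q) (trans (cong pr e) (pr-γ i)) (bounded s N≤s)

        q≤i : q ≤ toℕ i
        q≤i with often s₀
        ... | s , s₀≤s , pr≡q = subst (_≤ toℕ i) pr≡q
              (InColumn-pr (subst (λ s → InColumn i (prev s) (ρ s)) (m+[n∸m]≡n s₀≤s) (stays (s ∸ s₀))))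

        even-q′ : Even G (toℕ i)
        even-q′ = subst (Even G) (≤-antisym q≤i i≤q) even-q

  module ColumnLoses (S : Subset V) (j : Idx) (γ-P0 : playerOf (suc (toℕ j)) ≡ P0)
    (γ∈S : S γ[ j ]) (no-α-above : ∀ i → suc (toℕ j) ≡ toℕ i → ¬ S α[ i ]) where
    open OddColumn j γ-P0

    I : V → V → Set
    I p c = S c × InColumn j p c

    I-σ : ∀ p c → I p c → owner c ≡ P0 → ∀ w → E c w → S w → I c w
    I-σ _ _ (_ , at-γ) _ w e sw = sw , γMove⇒InColumn (moves-γ j w e) λ { i j+1≡i refl → no-α-above i j+1≡i sw }
    I-σ _ _ (_ , at-β) o = ⊥-elim (P0≢P1 (trans (sym o) β-P1))
    I-σ _ _ (_ , at-extra q e) o = ⊥-elim (P0≢P1 (trans (sym o) (extra-P1 q e)))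

    I-τ : ∀ p c → I p c → owner c ≡ P1 → E c (climb p c) × I c (climb p c)
    I-τ _ _ (_ , at-γ) o = ⊥-elim (P0≢P1 (trans (sym γ-P0) (trans (sym (owner-γ j)) o)))
    I-τ _ _ (_ , at-β) _ = move-βγ j , γ∈S , at-γ
    I-τ _ _ (_ , at-extra q e) _ = extra-back j q e , γ∈S , at-γ

    Column⇒¬W : ∀ v → InColumn j γ[ j ] v → ¬ W G P0 S v
    Column⇒¬W v in-column (v∈S , σ , legal , wins) =
      trapped-in-column⇒¬Wins ρ previous (λ t → moves t , step-P1 t refl) (λ _ → refl) 0 in-column
        (λ t _ i j+1≡i e → no-α-above i j+1≡i (subst S e (proj₁ (invariant (suc t)))))
        (wins ρ play consistent)
      where
      open PlayAgainst σ climb v γ[ j ]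
      open Invariant S legal I (v∈S , in-column) (λ _ _ → proj₁) I-σ I-τ

  data InBlock (b : ℕ) : V → V → Set where
    block-core : ∀ {p} κ i → toℕ i ≤ b → InBlock b p (inj₁ (κ , i))
    block-extra : ∀ i q → toℕ i ≤ b → E γ[ i ] (inj₂ q) → owner (inj₂ q) ≡ P1 → InBlock b γ[ i ] (inj₂ q)

  module BlockLoses (S : Subset V) (b : ℕ) (b≤2k : b ≤ 2 * k) (b-odd : playerOf b ≡ P1)
    (block⊆S : ∀ κ i → toℕ i ≤ b → S (inj₁ (κ , i)))
    (α-above∉S : ∀ i → toℕ i ≡ suc b → ¬ S α[ i ]) where

    I : V → V → Set
    I p c = S c × InBlock b p c

    I-σ : ∀ p c → I p c → owner c ≡ P0 → ∀ w → E c w → S w → I c w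
    I-σ _ _ (_ , block-core α i i≤b) _ w e sw rewrite moves-α i w e = sw , block-core β i i≤b
    I-σ _ _ (_ , block-core β i i≤b) _ w e sw with moves-β i w e
    ... | inj₁ refl = sw , block-core γ i i≤b
    ... | inj₂ (j , j+1≡i , refl) = sw , block-core α j (≤-trans (n≤1+n _) (subst (_≤ b) (sym j+1≡i) i≤b))
    I-σ _ _ (_ , block-core γ i i≤b) o w e sw = sw , γ-step (moves-γ i w e) sw
      where
      γ-step : ∀ {w} → γMove i w → S w → InBlock b γ[ i ] w
      γ-step to-γ _ = block-core γ i i≤b
      γ-step to-β _ = block-core β i i≤b
      γ-step (to-α j i+1≡j) sw with toℕ j ≟ suc b
      ... | yes j≡b+1 = ⊥-elim (α-above∉S j j≡b+1 sw)
      ... | no j≢b+1 = block-core α j (≤-pred (≤∧≢⇒< (subst (_≤ suc b) i+1≡j (s≤s i≤b)) j≢b+1))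
      γ-step (to-extra q e) _ =
        block-extra i q i≤b e (trans (extra-owner i q e) (playerOf-pred (toℕ i) (trans (sym (owner-γ i)) o)))
    I-σ _ _ (_ , block-extra i q _ _ q-P1) o = ⊥-elim (P0≢P1 (trans (sym o) q-P1))

    I-τ : ∀ p c → I p c → owner c ≡ P1 → E c (climb p c) × I c (climb p c)
    I-τ _ _ (_ , block-core α i i≤b) _ = move-αβ i , block⊆S β i i≤b , block-core β i i≤b
    I-τ _ _ (_ , block-core β i i≤b) _ = move-βγ i , block⊆S γ i i≤b , block-core γ i i≤b
    I-τ _ _ (_ , block-core γ i i≤b) o = move-γα i j (sym j≡i+1) , block⊆S α j j≤b , block-core α j j≤b
      where
      i-even : playerOf (toℕ i) ≡ P0
      i-even = playerOf-pred (toℕ i) (trans (sym (owner-γ i)) o)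
      i<b : suc (toℕ i) ≤ b
      i<b = ≤∧≢⇒< i≤b λ i≡b → P0≢P1 (trans (sym i-even) (trans (cong playerOf i≡b) b-odd))
      j : Idx
      j = idx (suc (toℕ i))
      j≡i+1 : toℕ j ≡ suc (toℕ i)
      j≡i+1 = toℕ-idx (suc (toℕ i)) (≤-trans i<b b≤2k)
      j≤b : toℕ j ≤ b
      j≤b = subst (_≤ b) (sym j≡i+1) i<b
    I-τ _ _ (_ , block-extra i q i≤b e _) _ = extra-back i q e , block⊆S γ i i≤b , block-core γ i i≤b

    module BlockPlay (σ : Strategy G) (legal : Legal G P0 S σ) (p v : V) (v∈S : S v) (in-block : InBlock b p v) where
      open PlayAgainst σ climb v p public
      open Invariant S legal I (v∈S , in-block) (λ _ _ → proj₁) I-σ I-τ public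

      trapped : ∀ i → playerOf (suc (toℕ i)) ≡ P0 → ∀ s₀ → ρ s₀ ≡ γ[ i ] →
                (∀ t → s₀ ≤ t → ∀ j → suc (toℕ i) ≡ toℕ j → ρ (suc t) ≢ α[ j ]) → ¬ Wins G P0 ρ
      trapped i γ-P0 s₀ e = OddColumn.trapped-in-column⇒¬Wins i γ-P0 ρ previous
        (λ t → moves t , step-P1 t refl) (λ _ → refl) s₀ (subst (InColumn i (previous s₀)) (sym e) at-γ)

      -- A limit priority q ≤ 2k is not that of any α, so eventually α is
      -- avoided and player 1's climbing ends in a column with γ owned by player 0.
      low-limit⇒¬Wins : (wins : Wins G P0 ρ) → proj₁ wins ≤ 2 * k → ⊥
      low-limit⇒¬Wins wins@(q , _ , _ , N , bounded) q≤2k = at-N (proj₂ (invariant N)) refl refl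
        where
        no-α : ∀ t → N ≤ t → ∀ j → ρ t ≢ α[ j ]
        no-α t N≤t j e = <⇒≱ (≤-<-trans q≤2k (2k<pr-α j)) (subst (λ x → pr x ≤ q) e (bounded t N≤t))

        trapped-after-N : ∀ i → playerOf (suc (toℕ i)) ≡ P0 → ∀ s₀ → N ≤ s₀ → ρ s₀ ≡ γ[ i ] → ⊥
        trapped-after-N i γ-P0 s₀ N≤s₀ e =
          trapped i γ-P0 s₀ e (λ t s₀≤t j _ → no-α (suc t) (≤-trans N≤s₀ (≤-trans s₀≤t (n≤1+n t))) j) wins

        at-N : ∀ {p c} → InBlock b p c → previous N ≡ p → ρ N ≡ c → ⊥
        at-N (block-core α i _) _ e = no-α N ≤-refl i e
        at-N (block-core β i _) _ e = by-owner (playerOf (toℕ i)) refl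
          where
          by-owner : ∀ o → playerOf (toℕ i) ≡ o → ⊥
          by-owner P1 o = trapped-after-N i (playerOf-succ (toℕ i) o) (suc N) (n≤1+n N)
                            (step-P1 N e (trans (owner-β i) o))
          by-owner P0 o with moves-β i (ρ (suc N)) (subst (λ x → E x (ρ (suc N))) e (moves N))
          ... | inj₁ e₁ = no-α (suc (suc N)) (≤-trans (n≤1+n N) (n≤1+n (suc N))) _
                            (step-P1 (suc N) e₁ (trans (owner-γ i) (playerOf-succ (toℕ i) o)))
          ... | inj₂ (j , _ , e₁) = no-α (suc N) (n≤1+n N) j e₁
        at-N (block-core γ i _) _ e = by-owner (playerOf (suc (toℕ i))) refl
          where
          by-owner : ∀ o → playerOf (suc (toℕ i)) ≡ o → ⊥
          by-owner P0 o = trapped-after-N i o N ≤-refl e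
          by-owner P1 o = no-α (suc N) (n≤1+n N) _ (step-P1 N e (trans (owner-γ i) o))
        at-N (block-extra i q _ eq q-P1) prev≡ e =
          trapped-after-N i (playerOf-succ (toℕ i) (trans (sym (extra-owner i q eq)) q-P1)) (suc N) (n≤1+n N)
            (trans (step-P1 N e q-P1) prev≡)

      -- A limit priority q > 2k is that of some α_i with i odd, and nothing
      -- above q occurs; from α_i player 1 climbs to γ_i and stays in that column.
      high-limit⇒¬Wins : (wins : Wins G P0 ρ) → ¬ proj₁ wins ≤ 2 * k → ⊥
      high-limit⇒¬Wins wins@(q , even-q , often , N , bounded) q≰2k = at-peak (proj₂ (invariant t)) refl
        where
        t : ℕ
        t = proj₁ (often N)
        N≤t : N ≤ t
        N≤t = proj₁ (proj₂ (often N))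

        pr≡q : ∀ {c} → ρ t ≡ c → pr c ≡ q
        pr≡q e = trans (cong pr (sym e)) (proj₂ (proj₂ (often N)))

        at-peak : ∀ {p c} → InBlock b p c → ρ t ≡ c → ⊥
        at-peak (block-core β i _) e = q≰2k (subst (_≤ 2 * k) (pr≡q e) (≤-trans (≤-reflexive (pr-β i)) (toℕ≤2k i)))
        at-peak (block-core γ i _) e = q≰2k (subst (_≤ 2 * k) (pr≡q e) (≤-trans (≤-reflexive (pr-γ i)) (toℕ≤2k i)))
        at-peak (block-extra i q _ _ _) e = q≰2k (subst (_≤ 2 * k) (pr≡q e) (pr-extra≤2k q))
        at-peak (block-core α i _) e = trapped i γ-P0 (suc (suc t)) reach-γ no-α-above wins
          where
          γ-P0 : playerOf (suc (toℕ i)) ≡ P0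
          γ-P0 = trans (sym (playerOf-pr-α i)) (subst (λ x → playerOf x ≡ P0) (sym (pr≡q e)) (Even⇒playerOf≡P0 even-q))
          i-odd : playerOf (toℕ i) ≡ P1
          i-odd = playerOf-pred (toℕ i) γ-P0
          reach-β : ρ (suc t) ≡ β[ i ]
          reach-β = step-P1 t e (trans (owner-α i) i-odd)
          reach-γ : ρ (suc (suc t)) ≡ γ[ i ]
          reach-γ = step-P1 (suc t) reach-β (trans (owner-β i) i-odd)
          no-α-above : ∀ s → suc (suc t) ≤ s → ∀ j → suc (toℕ i) ≡ toℕ j → ρ (suc s) ≢ α[ j ]
          no-α-above s t+2≤s j i+1≡j e′ =
            1+n≰n (subst (_≤ q) (trans (cong pr e′) (trans (pr-α-suc i j i+1≡j) (cong suc (pr≡q e))))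
                         (bounded (suc s) (≤-trans N≤t (m≤n⇒m≤1+n (≤-trans (n≤1+n t) (≤-trans (n≤1+n (suc t)) t+2≤s))))))

    InBlock⇒¬W : ∀ p v → InBlock b p v → ¬ W G P0 S v
    InBlock⇒¬W p v in-block (v∈S , σ , legal , winning) = refute (winning ρ play consistent)
      where
      open BlockPlay σ legal p v v∈S in-block
      refute : Wins G P0 ρ → ⊥
      refute wins with proj₁ wins ≤? 2 * k
      ... | yes q≤2k = low-limit⇒¬Wins wins q≤2k
      ... | no q≰2k = high-limit⇒¬Wins wins q≰2k

  -- Player 0 wins a column with γ_j owned by player 1 that cannot be left
  -- upwards, by moving back to γ_j whenever possible: the play then sees γ_j
  -- infinitely often and nothing above the even priority j.
  module EvenColumnWins (S : Subset V) (total : Total S) (j : Idx) (γ-P1 : playerOf (suc (toℕ j)) ≡ P1)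
    (γ∈S : S γ[ j ]) (no-α-above : ∀ i → suc (toℕ j) ≡ toℕ i → ¬ S α[ i ]) where

    j-even : playerOf (toℕ j) ≡ P0
    j-even = playerOf-pred (toℕ j) γ-P1

    GoodMove : V → V → Set
    GoodMove u w = (S u → owner u ≡ P0 → S w × E u w) × (E u γ[ j ] → w ≡ γ[ j ])

    good-move : ∀ u → ¬ ¬ ∃ (GoodMove u)
    good-move u = ¬¬-excluded-middle {A = E u γ[ j ]} >>= λ
      { (yes u→γ) → pure (γ[ j ] , (λ _ _ → γ∈S , u→γ) , λ _ → refl)
      ; (no u↛γ) → ¬¬-excluded-middle {A = S u × owner u ≡ P0} >>= λ
        { (yes (u∈S , o)) → total u u∈S >>= λ { (w , e , w∈S) → pure (w , (λ _ _ → w∈S , e) , λ e′ → ⊥-elim (u↛γ e′)) }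
        ; (no ¬P0-in-S) → pure (u , (λ u∈S o → ⊥-elim (¬P0-in-S (u∈S , o))) , λ e′ → ⊥-elim (u↛γ e′)) } }

    Column⇒W : ∀ v → InColumn j γ[ j ] v → S v → ¬ ¬ W G P0 S v
    Column⇒W v in-column v∈S = dns-ExtPos k m (λ u → ∃ (GoodMove u)) good-move >>= λ F →
      pure (v∈S , (λ _ u → proj₁ (F u)) , (λ _ u u∈S o → proj₁ (proj₂ (F u)) u∈S o) , wins F)
      where
      wins : (F : ∀ u → ∃ (GoodMove u)) → ∀ ρ → Play G S v ρ →
             Consistent G P0 (λ _ u → proj₁ (F u)) ρ → Wins G P0 ρ
      wins F ρ play consistent =
        toℕ j , playerOf≡P0⇒Even (toℕ j) j-even , often , 0 , λ t _ → InColumn-pr (stays t)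
        where
        open Play play

        back-to-γ : ∀ t {c} → ρ t ≡ c → owner c ≡ P0 → E c γ[ j ] → ρ (suc t) ≡ γ[ j ]
        back-to-γ t refl o e = trans (consistent t o) (proj₂ (proj₂ (F (ρ t))) e)

        next : ∀ t {c} → ρ t ≡ c → InColumn j γ[ j ] c →
               InColumn j γ[ j ] (ρ (suc t)) × (ρ t ≡ γ[ j ] ⊎ ρ (suc t) ≡ γ[ j ])
        next t e at-γ = γMove⇒InColumn (moves-γ j _ (subst (λ x → E x (ρ (suc t))) e (step t)))
                          (λ i j+1≡i e′ → no-α-above i j+1≡i (subst S e′ (inS (suc t)))) , inj₁ e
        next t e at-β = subst (InColumn j γ[ j ]) (sym r) at-γ , inj₂ r
          where r = back-to-γ t e (trans (owner-β j) j-even) (move-βγ j)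
        next t e (at-extra q eq) = subst (InColumn j γ[ j ]) (sym r) at-γ , inj₂ r
          where r = back-to-γ t e (trans (extra-owner j q eq) j-even) (extra-back j q eq)

        stays : ∀ t → InColumn j γ[ j ] (ρ t)
        stays zero = subst (InColumn j γ[ j ]) (sym start) in-column
        stays (suc t) = proj₁ (next t refl (stays t))

        often : ∀ N → ∃ λ t → N ≤ t × pr (ρ t) ≡ toℕ j
        often N with proj₂ (next N refl (stays N))
        ... | inj₁ e = N , ≤-refl , trans (cong pr e) (pr-γ j)
        ... | inj₂ e = suc N , n≤1+n N , trans (cong pr e) (pr-γ j)

  z≤2k : ∀ w → z w ≤ 2 * k
  z≤2k w = *-monoʳ-≤ 2 (m∸n≤m k (len w))

  z-even : ∀ w → playerOf (z w) ≡ P0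
  z-even w = playerOf-2* (k ∸ len w)

  z-▹ : ∀ w d → len w < k → z w ≡ suc (suc (z (w ▹ d)))
  z-▹ w d len<k = trans (cong (2 *_) (+-∸-assoc 1 len<k)) (*-distribˡ-+ 2 1 (k ∸ suc (len w)))

  z-≼ : ∀ {u d w} → (u ▹ d) ≼ w → len w ≤ k → suc (suc (z w)) ≤ z u
  z-≼ {u} {w = w} u▹d≼w len≤k = subst (_≤ z u) (*-distribˡ-+ 2 1 (k ∸ len w))
    (*-monoʳ-≤ 2 (∸-monoʳ-< (≼⇒len≤ u▹d≼w) len≤k))

  z-injective : ∀ w w′ → len w ≤ k → len w′ ≤ k → z w ≡ z w′ → len w ≡ len w′
  z-injective w w′ len≤k len′≤k z≡z′ =
    ∸-cancelˡ-≡ len≤k len′≤k (*-cancelˡ-≡ (k ∸ len w) (k ∸ len w′) 2 z≡z′)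

  1+z≢z : ∀ w w′ → suc (z w) ≢ z w′
  1+z≢z w w′ e = P0≢P1 (trans (sym (z-even w′)) (trans (cong playerOf (sym e)) (playerOf-succ (z w) (z-even w))))

  -- z u ∸ 1 is truncated: below a leaf (z u = 0) the marker is γ_0.
  marker : Word → Idx
  marker u = idx (z u ∸ 1)

  toℕ-marker : ∀ u → toℕ (marker u) ≡ z u ∸ 1
  toℕ-marker u = toℕ-idx (z u ∸ 1) (≤-trans (m∸n≤m (z u) 1) (z≤2k u))

  suc-marker : ∀ u → 1 ≤ z u → suc (toℕ (marker u)) ≡ z u
  suc-marker u 1≤z = trans (cong suc (toℕ-marker u)) (m+[n∸m]≡n 1≤z)

  marker-P0 : ∀ u → 1 ≤ z u → playerOf (suc (toℕ (marker u))) ≡ P0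
  marker-P0 u 1≤z = trans (cong playerOf (suc-marker u 1≤z)) (z-even u)

  marker-leaf : ∀ u → z u ≡ 0 → toℕ (marker u) ≡ z u
  marker-leaf u z≡0 = trans (toℕ-marker u) (trans (cong (_∸ 1) z≡0) (sym z≡0))

  Marked : Word → Dir → Subset V → Set
  Marked u L S = S γ[ marker u ]
  Marked u R S = ¬ S γ[ marker u ]

  Marked-∖ : ∀ u d {S A : Subset V} → Marked u d S → (d ≡ L → ¬ A γ[ marker u ]) → Marked u d (S ∖ A)
  Marked-∖ u L γ∈S γ∉A = γ∈S , γ∉A refl
  Marked-∖ u R γ∉S _ = λ γ∈S∖A → γ∉S (proj₁ γ∈S∖A)

  record ShapeG (w : Word) : Set where
    field
      core∈ : ∀ κ i → toℕ i ≤ z w → Gw w (inj₁ (κ , i))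
      α∉ : ∀ i → z w < toℕ i → ¬ Gw w α[ i ]
      marked : ∀ u d → (u ▹ d) ≼ w → Marked u d (Gw w)

  record ShapeG′ (w : Word) (d : Dir) : Set where
    field
      core∈ : ∀ κ i → suc (suc (toℕ i)) ≤ z w → G'w w d (inj₁ (κ , i))
      αβ-top∈ : ∀ i → suc (toℕ i) ≡ z w → G'w w d α[ i ] × G'w w d β[ i ]
      α∉ : ∀ i → z w ≤ toℕ i → ¬ G'w w d α[ i ]
      marked : ∀ u d′ → (u ▹ d′) ≼ (w ▹ d) → Marked u d′ (G'w w d)

  shapeG-ε : ShapeG ε
  shapeG-ε = record
    { core∈ = λ _ _ _ → tt
    ; α∉ = λ i z<i _ → <⇒≱ z<i (toℕ≤2k i)
    ; marked = λ _ _ () }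

  marker-not-P1 : ∀ {u d w} → (u ▹ d) ≼ w → len w ≤ k → owner γ[ marker u ] ≢ P1
  marker-not-P1 {u} u▹d≼w len≤k o =
    P0≢P1 (trans (sym (marker-P0 u (≤-trans (s≤s z≤n) (z-≼ u▹d≼w len≤k)))) (trans (sym (owner-γ (marker u))) o))

  module LeftChild (w : Word) (len≤k : len w ≤ k) (shape : ShapeG w) where
    open ShapeG shape

    P1-stuck : ∀ (i : Idx) → playerOf (suc (toℕ i)) ≡ P1 → toℕ i < z w → suc (toℕ i) < z w
    P1-stuck i o i<z = ≤∧≢⇒< i<z λ e → P0≢P1 (trans (sym (z-even w)) (trans (cong playerOf (sym e)) o))

    open BelowTrap P1 (z w) (Gw w) (alphaAt (z w)) (λ κ i i<z → core∈ κ i (<⇒≤ i<z)) P1-stuck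
      (λ v below _ → Below∉alphaAt P1 (z w) v below) using (Below⇒¬Attr)

    below∈ : ∀ κ i → toℕ i < z w → G'L w (inj₁ (κ , i))
    below∈ κ i i<z = core∈ κ i (<⇒≤ i<z) , Below⇒¬Attr _ (core κ i i<z)

    top∈ : ∀ j → toℕ j ≡ z w → G'L w γ[ j ] × G'L w β[ j ]
    top∈ j j≡z = (core∈ γ j (≤-reflexive j≡z) , Column⇒¬Attr _ at-γ)
               , (core∈ β j (≤-reflexive j≡z) , Column⇒¬Attr _ at-β)
      where
      open ColumnTrap P1 j (Gw w) (alphaAt (z w)) (playerOf-succ (toℕ j) (trans (cong playerOf j≡z) (z-even w)))
        (core∈ γ j (≤-reflexive j≡z)) (λ i j+1≡i → α∉ i (subst (_≤ toℕ i) (cong suc j≡z) (≤-reflexive j+1≡i)))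
        (λ v col _ → Column∉alphaAt j (z w) v col) using (Column⇒¬Attr)

    marker∈ : G'L w γ[ marker w ]
    marker∈ with z w ≟ 0
    ... | yes z≡0 = proj₁ (top∈ (marker w) (marker-leaf w z≡0))
    ... | no z≢0 = below∈ γ (marker w) (subst (_< z w) (sym (toℕ-marker w)) (∸-monoʳ-< (s≤s z≤n) (n≢0⇒n>0 z≢0)))

    α-top∉ : ∀ i → z w ≤ toℕ i → ¬ G'L w α[ i ]
    α-top∉ i z≤i (α∈ , α∉A) with z w ≟ toℕ i
    ... | yes z≡i = α∉A (base α∈ (i , refl , sym z≡i))
    ... | no z≢i = α∉ i (≤∧≢⇒< z≤i z≢i) α∈

    marked-L : ∀ u d → (u ▹ d) ≼ (w ▹ L) → Marked u d (G'L w)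
    marked-L u d ≼-refl = marker∈
    marked-L u d (≼-step u▹d≼w) = Marked-∖ u d (marked u d u▹d≼w) λ _ →
      γ∉Attr-of-nonowner P1 (marker u) (Gw w) (alphaAt (z w)) (marker-not-P1 u▹d≼w len≤k) (γ∉alphaAt (z w) (marker u))

    shape-L : ShapeG′ w L
    shape-L = record
      { core∈ = λ κ i i+2≤z → below∈ κ i (≤-trans (n≤1+n (suc (toℕ i))) i+2≤z)
      ; αβ-top∈ = λ i i+1≡z → below∈ α i (≤-reflexive i+1≡z) , below∈ β i (≤-reflexive i+1≡z)
      ; α∉ = α-top∉
      ; marked = marked-L }

  total-Gw : ∀ w → Total (Gw w)
  total-G'w : ∀ w d → Total (G'w w d)
  total-Gw ε v _ = pure (proj₁ (total v) , proj₂ (total v) , tt)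
  total-Gw (w ▹ d) = Total-∖Attr (dns-ExtPos k m) (total-G'w w d)
  total-G'w w L = Total-∖Attr (dns-ExtPos k m) (total-Gw w)
  total-G'w w R = Total-∖Attr (dns-ExtPos k m) (total-Gw w)

  module RightChild (w : Word) (len≤k : len w ≤ k) (shape : ShapeG w) where
    open ShapeG shape
    open LeftChild w len≤k shape using (top∈; shape-L)
    module L = ShapeG′ shape-L

    X : Subset V
    X = W G P0 (G'L w)

    wins-top : ∀ j → toℕ j ≡ z w → ¬ ¬ X γ[ j ] × ¬ ¬ X β[ j ]
    wins-top j j≡z = Column⇒W γ[ j ] at-γ (proj₁ (top∈ j j≡z)) , Column⇒W β[ j ] at-β (proj₂ (top∈ j j≡z))
      where
      open EvenColumnWins (G'L w) (total-G'w w L) j (playerOf-succ (toℕ j) (trans (cong playerOf j≡z) (z-even w)))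
        (proj₁ (top∈ j j≡z)) (λ i j+1≡i α∈ → α∉ i (subst (_≤ toℕ i) (cong suc j≡z) (≤-reflexive j+1≡i)) (proj₁ α∈))

    -- The block below the marker γ_b, together with α_b and β_b: player 1 can
    -- keep the play inside it, and player 0 loses G'_{wL} from all of it.
    module TopBlock (b : ℕ) (b+1≡z : suc b ≡ z w) where

      b-odd : playerOf b ≡ P1
      b-odd = playerOf-pred b (trans (cong playerOf b+1≡z) (z-even w))

      b≤z : b ≤ z w
      b≤z = ≤-trans (n≤1+n b) (≤-reflexive b+1≡z)

      b≤2k : b ≤ 2 * k
      b≤2k = ≤-trans b≤z (z≤2k w)

      b≡marker : b ≡ toℕ (marker w)
      b≡marker = sym (trans (toℕ-marker w) (cong (_∸ 1) (sym b+1≡z)))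

      block⊆L : ∀ κ i → toℕ i ≤ b → G'L w (inj₁ (κ , i))
      block⊆L κ i i≤b with toℕ i ≟ b
      block⊆L α i _ | yes i≡b = proj₁ (L.αβ-top∈ i (trans (cong suc i≡b) b+1≡z))
      block⊆L β i _ | yes i≡b = proj₂ (L.αβ-top∈ i (trans (cong suc i≡b) b+1≡z))
      block⊆L γ i _ | yes i≡b =
        subst (λ j → G'L w γ[ j ]) (sym (toℕ-injective (trans i≡b b≡marker))) (L.marked w L ≼-refl)
      block⊆L κ i i≤b | no i≢b = L.core∈ κ i (subst (suc (suc (toℕ i)) ≤_) b+1≡z (s≤s (≤∧≢⇒< i≤b i≢b)))

      open BlockLoses (G'L w) b b≤2k b-odd block⊆L (λ i i≡b+1 → L.α∉ i (≤-reflexive (trans (sym b+1≡z) (sym i≡b+1))))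
        using (InBlock⇒¬W)

      data InTopBlock : V → Set where
        below : ∀ {v} → Below P0 b v → InTopBlock v
        top-α : ∀ i → toℕ i ≡ b → InTopBlock α[ i ]
        top-β : ∀ i → toℕ i ≡ b → InTopBlock β[ i ]

      avoids : ∀ v → InTopBlock v → Gw w v → ¬ X v
      avoids _ (below (core κ i i<b)) _ = InBlock⇒¬W γ[ i ] _ (block-core κ i (<⇒≤ i<b))
      avoids _ (below (extra i q i<b e q≢P0)) _ = InBlock⇒¬W γ[ i ] _ (block-extra i q (<⇒≤ i<b) e (≢P0⇒≡P1 q≢P0))
      avoids _ (top-α i i≡b) _ = InBlock⇒¬W α[ i ] _ (block-core α i (≤-reflexive i≡b))
      avoids _ (top-β i i≡b) _ = InBlock⇒¬W β[ i ] _ (block-core β i (≤-reflexive i≡b))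

      core-below∈ : ∀ κ (i : Idx) → toℕ i < b → Gw w (inj₁ (κ , i))
      core-below∈ κ i i<b = core∈ κ i (≤-trans (<⇒≤ i<b) b≤z)

      P0-stuck : ∀ (i : Idx) → playerOf (suc (toℕ i)) ≡ P0 → toℕ i < b → suc (toℕ i) < b
      P0-stuck i o i<b = ≤∧≢⇒< i<b λ e → P0≢P1 (trans (sym o) (trans (cong playerOf e) b-odd))

      module B = BelowTrap P0 b (Gw w) X core-below∈ P0-stuck (λ v t → avoids v (below t))

      closed : ∀ v → InTopBlock v → Gw w v → owner v ≡ P0 → ∀ u → E v u → Gw w u → InTopBlock u
      closed v (below t) v∈ o u e u∈ = below (B.closed v t v∈ o u e u∈)
      closed _ (top-α i i≡b) _ o = ⊥-elim (P0≢P1 (trans (sym o) (trans (owner-α i) (trans (cong playerOf i≡b) b-odd))))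
      closed _ (top-β i i≡b) _ o = ⊥-elim (P0≢P1 (trans (sym o) (trans (owner-β i) (trans (cong playerOf i≡b) b-odd))))

      escape : ∀ v → InTopBlock v → Gw w v → owner v ≢ P0 → ∃ λ u → E v u × Gw w u × InTopBlock u
      escape v (below t) v∈ o with B.escape v t v∈ o
      ... | u , e , u∈ , t′ = u , e , u∈ , below t′
      escape _ (top-α i i≡b) _ _ = β[ i ] , move-αβ i , core∈ β i (≤-trans (≤-reflexive i≡b) b≤z) , top-β i i≡b
      escape _ (top-β i i≡b) _ _ = α[ j ] , move-βα i j (trans (cong suc j≡b-1) (trans b-1+1≡b (sym i≡b))) ,
                                   core-below∈ α j j<b , below (core α j j<b)
        where
        b≢0 : b ≢ 0
        b≢0 b≡0 = P0≢P1 (trans (cong playerOf (sym b≡0)) b-odd)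
        b-1+1≡b : suc (pred b) ≡ b
        b-1+1≡b = suc-pred b {{≢-nonZero b≢0}}
        j : Idx
        j = idx (pred b)
        j≡b-1 : toℕ j ≡ pred b
        j≡b-1 = toℕ-idx (pred b) (≤-trans pred[n]≤n b≤2k)
        j<b : toℕ j < b
        j<b = subst (_≤ b) (cong suc (sym j≡b-1)) (≤-reflexive b-1+1≡b)

      InTopBlock⇒¬Attr : ∀ v → InTopBlock v → ¬ Attr G P0 (Gw w) X v
      InTopBlock⇒¬Attr = trap⇒¬Attr record { avoids = avoids ; closed = closed ; escape = escape }

    marker∉Attr : ∀ u → (u ▹ L) ≼ w → ¬ Attr G P0 (Gw w) X γ[ marker u ]
    marker∉Attr u u▹L≼w = Column⇒¬Attr γ[ marker u ] at-γ
      where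
      1≤z : 1 ≤ z u
      1≤z = ≤-trans (s≤s z≤n) (z-≼ u▹L≼w len≤k)
      no-α-above : ∀ i → suc (toℕ (marker u)) ≡ toℕ i → ¬ Gw w α[ i ]
      no-α-above i x = α∉ i (subst (suc (z w) ≤_) (trans (sym (suc-marker u 1≤z)) x) (≤-trans (n≤1+n _) (z-≼ u▹L≼w len≤k)))
      open ColumnLoses (G'L w) (marker u) (marker-P0 u 1≤z) (L.marked u L (≼-step u▹L≼w))
        (λ i x α∈ → no-α-above i x (proj₁ α∈)) using (Column⇒¬W)
      open ColumnTrap P0 (marker u) (Gw w) X (marker-P0 u 1≤z) (marked u L u▹L≼w) no-α-above
        (λ v col _ → Column⇒¬W v col) using (Column⇒¬Attr)

    α-top∉ : ∀ i → z w ≤ toℕ i → ¬ G'w w R α[ i ]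
    α-top∉ i z≤i (α∈ , α∉A) with z w ≟ toℕ i
    ... | no z≢i = α∉ i (≤∧≢⇒< z≤i z≢i) α∈
    ... | yes z≡i = proj₂ (wins-top i (sym z≡i)) λ β∈X →
          α∉A (own β[ i ] α∈ (trans (owner-α i) (trans (cong playerOf (sym z≡i)) (z-even w))) (move-αβ i) β∈ (base β∈ β∈X))
      where
      β∈ : Gw w β[ i ]
      β∈ = core∈ β i (≤-reflexive (sym z≡i))

    -- The marker γ_{z-1} belongs to player 0 and moves to α_z, whence player 0
    -- reaches β_z ∈ W^0(G'_{wL}); at a leaf the marker γ_0 is itself winning.
    marker∉ : ¬ G'w w R γ[ marker w ]
    marker∉ (γ∈ , γ∉A) with z w ≟ 0
    ... | yes z≡0 = proj₁ (wins-top (marker w) (marker-leaf w z≡0)) λ γ∈X → γ∉A (base γ∈ γ∈X)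
    ... | no z≢0 = proj₂ (wins-top j j≡z) λ β∈X →
          γ∉A (own α[ j ] γ∈ (trans (owner-γ (marker w)) (marker-P0 w 1≤z)) (move-γα (marker w) j (trans (suc-marker w 1≤z) (sym j≡z))) α∈
                (own β[ j ] α∈ (trans (owner-α j) (trans (cong playerOf j≡z) (z-even w))) (move-αβ j) β∈ (base β∈ β∈X)))
      where
      1≤z : 1 ≤ z w
      1≤z = n≢0⇒n>0 z≢0
      j : Idx
      j = idx (z w)
      j≡z : toℕ j ≡ z w
      j≡z = toℕ-idx (z w) (z≤2k w)
      α∈ : Gw w α[ j ]
      α∈ = core∈ α j (≤-reflexive j≡z)
      β∈ : Gw w β[ j ]
      β∈ = core∈ β j (≤-reflexive j≡z)

    marked-R : ∀ u d → (u ▹ d) ≼ (w ▹ R) → Marked u d (G'w w R)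
    marked-R u d ≼-refl = marker∉
    marked-R u d (≼-step u▹d≼w) = Marked-∖ u d (marked u d u▹d≼w) λ { refl → marker∉Attr u u▹d≼w }

    shape-R : ShapeG′ w R
    shape-R = record
      { core∈ = λ κ i i+2≤z → core∈ κ i (≤-trans (n≤1+n _) (≤-trans (n≤1+n _) i+2≤z)) ,
          TopBlock.InTopBlock⇒¬Attr (pred (z w)) (suc-pred (z w) {{>-nonZero (≤-trans (s≤s z≤n) i+2≤z)}}) _
            (TopBlock.below (core κ i (pred-mono-≤ i+2≤z)))
      ; αβ-top∈ = λ i i+1≡z →
          (core∈ α i (≤-trans (n≤1+n _) (≤-reflexive i+1≡z)) , TopBlock.InTopBlock⇒¬Attr (toℕ i) i+1≡z _ (TopBlock.top-α i refl)) ,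
          (core∈ β i (≤-trans (n≤1+n _) (≤-reflexive i+1≡z)) , TopBlock.InTopBlock⇒¬Attr (toℕ i) i+1≡z _ (TopBlock.top-β i refl))
      ; α∉ = α-top∉
      ; marked = marked-R }

  module NextG (w : Word) (d : Dir) (len<k : len w < k) (shape : ShapeG′ w d) where
    open ShapeG′ shape

    z≡ : z w ≡ suc (suc (z (w ▹ d)))
    z≡ = z-▹ w d len<k

    P0-stuck : ∀ (i : Idx) → playerOf (suc (toℕ i)) ≡ P0 → toℕ i < suc (z (w ▹ d)) → suc (toℕ i) < suc (z (w ▹ d))
    P0-stuck i o i<b = ≤∧≢⇒< i<b λ e →
      P0≢P1 (trans (sym o) (trans (cong playerOf e) (playerOf-succ (z (w ▹ d)) (z-even (w ▹ d)))))

    below∈ : ∀ κ (i : Idx) → toℕ i < suc (z (w ▹ d)) → G'w w d (inj₁ (κ , i))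
    below∈ κ i i<b = core∈ κ i (subst (suc (suc (toℕ i)) ≤_) (sym z≡) (s≤s i<b))

    open BelowTrap P0 (suc (z (w ▹ d))) (G'w w d) (alphaAt (suc (z (w ▹ d)))) below∈ P0-stuck
      (λ v below _ → Below∉alphaAt P0 _ v below) using (Below⇒¬Attr)

    marker∉Attr : ∀ u → (u ▹ L) ≼ (w ▹ d) → ¬ Attr G P0 (G'w w d) (alphaAt (suc (z (w ▹ d)))) γ[ marker u ]
    marker∉Attr u u▹L≼wd = Column⇒¬Attr γ[ marker u ] at-γ
      where
      z≤z : suc (suc (z (w ▹ d))) ≤ z u
      z≤z = z-≼ u▹L≼wd len<k
      1≤z : 1 ≤ z u
      1≤z = ≤-trans (s≤s z≤n) z≤z
      open ColumnTrap P0 (marker u) (G'w w d) (alphaAt (suc (z (w ▹ d)))) (marker-P0 u 1≤z) (marked u L u▹L≼wd)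
        (λ i x → α∉ i (subst (_≤ toℕ i) (sym z≡) (subst (suc (suc (z (w ▹ d))) ≤_) (trans (sym (suc-marker u 1≤z)) x) z≤z)))
        (λ v col _ → Column∉alphaAt (marker u) _ v col) using (Column⇒¬Attr)

    shape-▹ : ShapeG (w ▹ d)
    shape-▹ = record
      { core∈ = λ κ i i≤z → below∈ κ i (s≤s i≤z) , Below⇒¬Attr _ (core κ i (s≤s i≤z))
      ; α∉ = α-above∉
      ; marked = λ u d′ u▹d′≼wd → Marked-∖ u d′ (marked u d′ u▹d′≼wd) λ { refl → marker∉Attr u u▹d′≼wd } }
      where
      α-above∉ : ∀ i → z (w ▹ d) < toℕ i → ¬ Gw (w ▹ d) α[ i ]
      α-above∉ i z<i (α∈ , α∉A) with toℕ i ≟ suc (z (w ▹ d))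
      ... | yes i≡z+1 = α∉A (base α∈ (i , refl , i≡z+1))
      ... | no i≢z+1 = α∉ i (subst (_≤ toℕ i) (sym z≡) (≤∧≢⇒< z<i (λ e → i≢z+1 (sym e)))) α∈

  shapeG : ∀ w → len w ≤ k → ShapeG w
  shapeG′ : ∀ w d → len w ≤ k → ShapeG′ w d
  shapeG ε _ = shapeG-ε
  shapeG (w ▹ d) len<k = NextG.shape-▹ w d len<k (shapeG′ w d (<⇒≤ len<k))
  shapeG′ w L len≤k = LeftChild.shape-L w len≤k (shapeG w len≤k)
  shapeG′ w R len≤k = RightChild.shape-R w len≤k (shapeG w len≤k)

  height : Node → ℕ
  height (gN w) = suc (z w)
  height (g'N w _) = z w

  word : Node → Word
  word (gN w) = w
  word (g'N w d) = w ▹ d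

  height≤ : ∀ a → height a ≤ suc (2 * k)
  height≤ (gN w) = s≤s (z≤2k w)
  height≤ (g'N w _) = m≤n⇒m≤1+n (z≤2k w)

  α∈-below-height : ∀ a → InTree a → ∀ i → toℕ i < height a → game a α[ i ]
  α∈-below-height (gN w) len≤k i i<h = ShapeG.core∈ (shapeG w len≤k) α i (≤-pred i<h)
  α∈-below-height (g'N w d) len≤k i i<h with suc (toℕ i) ≟ z w
  ... | yes i+1≡z = proj₁ (ShapeG′.αβ-top∈ (shapeG′ w d (≤-pred len≤k)) i i+1≡z)
  ... | no i+1≢z = ShapeG′.core∈ (shapeG′ w d (≤-pred len≤k)) α i (≤∧≢⇒< i<h i+1≢z)

  α∉-above-height : ∀ a → InTree a → ∀ i → height a ≤ toℕ i → ¬ game a α[ i ]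
  α∉-above-height (gN w) len≤k = ShapeG.α∉ (shapeG w len≤k)
  α∉-above-height (g'N w d) len≤k = ShapeG′.α∉ (shapeG′ w d (≤-pred len≤k))

  marked-node : ∀ a → InTree a → ∀ u d → (u ▹ d) ≼ word a → Marked u d (game a)
  marked-node (gN w) len≤k = ShapeG.marked (shapeG w len≤k)
  marked-node (g'N w d) len≤k = ShapeG′.marked (shapeG′ w d (≤-pred len≤k))

  different-heights : ∀ a b → InTree a → InTree b → height a < height b → ¬ SameSet (game a) (game b)
  different-heights a b a∈T b∈T h<h′ same =
    α∉-above-height a a∈T i (≤-reflexive (sym i≡h)) (proj₂ (same α[ i ]) (α∈-below-height b b∈T i (subst (_< height b) (sym i≡h) h<h′)))
    where
    i : Idx
    i = idx (height a)
    i≡h : toℕ i ≡ height a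
    i≡h = toℕ-idx (height a) (≤-pred (≤-trans h<h′ (height≤ b)))

  different-words : ∀ a b → InTree a → InTree b → len (word a) ≡ len (word b) → word a ≢ word b →
                    ¬ SameSet (game a) (game b)
  different-words a b a∈T b∈T len≡ w≢w′ same = at-first-difference (first-difference (word a) (word b) len≡ w≢w′)
    where
    by-letters : ∀ u d d′ → d ≢ d′ → Marked u d (game a) → Marked u d′ (game b) → ⊥
    by-letters _ L L L≢L _ _ = L≢L refl
    by-letters _ R R R≢R _ _ = R≢R refl
    by-letters _ L R _ γ∈a γ∉b = γ∉b (proj₁ (same _) γ∈a)
    by-letters _ R L _ γ∉a γ∈b = γ∉a (proj₂ (same _) γ∈b)

    at-first-difference : (∃ λ u → ∃ λ d → ∃ λ d′ → d ≢ d′ × (u ▹ d) ≼ word a × (u ▹ d′) ≼ word b) → ⊥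
    at-first-difference (u , d , d′ , d≢d′ , p , p′) =
      by-letters u d d′ d≢d′ (marked-node a a∈T u d p) (marked-node b b∈T u d′ p′)

  -- Heights separate levels and the two kinds of games (G_w has odd height,
  -- G'_{wd} even); within a level the first differing letter separates.
  distinct : ∀ a b → InTree a → InTree b → a ≢ b → ¬ SameSet (game a) (game b)
  distinct a b a∈T b∈T a≢b with <-cmp (height a) (height b)
  ... | tri< h<h′ _ _ = different-heights a b a∈T b∈T h<h′
  ... | tri> _ _ h>h′ = λ same → different-heights b a b∈T a∈T h>h′ (SameSet-sym same)
  ... | tri≈ _ h≡h′ _ = equal-heights a b a∈T b∈T a≢b h≡h′
    where
    equal-heights : ∀ a b → InTree a → InTree b → a ≢ b → height a ≡ height b → ¬ SameSet (game a) (game b)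
    equal-heights (gN w) (gN w′) a∈T b∈T a≢b h≡h′ =
      different-words (gN w) (gN w′) a∈T b∈T (z-injective w w′ a∈T b∈T (suc-injective h≡h′)) λ e → a≢b (cong gN e)
    equal-heights (gN w) (g'N w′ _) _ _ _ h≡h′ = ⊥-elim (1+z≢z w w′ h≡h′)
    equal-heights (g'N w _) (gN w′) _ _ _ h≡h′ = ⊥-elim (1+z≢z w′ w (sym h≡h′))
    equal-heights (g'N w d) (g'N w′ d′) a∈T b∈T a≢b h≡h′ =
      different-words (g'N w d) (g'N w′ d′) a∈T b∈T (cong suc (z-injective w w′ (≤-pred a∈T) (≤-pred b∈T) h≡h′))
        λ e → a≢b (cong₂ g'N (proj₁ (▹-injective e)) (proj₂ (▹-injective e)))

lemma4 : (m : ℕ → ℕ) (G : (k : ℕ) → Game (ExtPos k (m k)))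
         → (∀ k → 1 ≤ k → IsCoreExtension k (m k) (G k))
         → ∀ k → 1 ≤ k
         → let open Tree k (m k) (G k) in
           (∀ a b → InTree a → InTree b → a ≢ b → ¬ SameSet (game a) (game b))
           × Σ (Fin (3 * (2 ^ (k + 1) ∸ 1)) → Node) λ f →
               (∀ i → InTree (f i))
               × (∀ i j → i ≢ j → ¬ SameSet (game (f i)) (game (f j)))
               × (∀ a → InTree a → Σ (Fin (3 * (2 ^ (k + 1) ∸ 1))) λ i → SameSet (game a) (game (f i)))
lemma4 m G ext k 1≤k = distinct , enumerate distinct (cong (3 *_) (wordCount≡ k))
  where
  open CoreExtension k (m k) (G k) (ext k 1≤k) using (distinct)
  open NodeEnumeration k (m k) (G k) using (enumerate)
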